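{- Consider the unbiased Waiter-Client triangle-factor game on $K_n$ ($n$ divisible by $3$), with connected components of Client's graph classified as good or bad as described below. If Waiter won the game, and throughout the game at most $\frac{n}{6}$ connected components of Client's graph were declared to be good, then Client's final graph contains at least $\frac{7}{6}n$ edges.
   Context: The game: initially all edges of $K_n$ are unclaimed. In each round Waiter offers two yet unclaimed edges; Client chooses one to be added to Client's graph, the other is added to Waiter's graph. Waiter wins (and the game ends) when Client's graph contains a $K_3$-factor ($n/3$ vertex-disjoint triangles covering all vertices). Client's final graph is Client's graph at the end of the game. Good/bad components: when a new connected component is created in Client's graph it is initially called bad. Whenever Client adds an edge $ab$ to his graph, the status of the component containing $ab$ is updated: (1) if both $a$ and $b$ already lie in good components (the same or different ones), the new component is good; (2) if $ab$ joins a good and a bad component, or adds a new vertex to a good component, the new component is good; (3) if neither $a$ nor $b$ lay in a good component before $ab$ was added, but after adding $ab$ the component $K$ containing $ab$ has a triangle-factor and satisfies $|E(K)| = \frac{4}{3}|V(K)|-1$, then the component is good, and in this case (and only in this case) we say that this component was declared to be good (a new good component was created); (4) in every other case the component containing $ab$ is bad. -}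

module Defs where

open import Data.Nat using (ℕ; zero; suc; _+_; _*_; _<_)
open import Data.Fin as Fin using (Fin)
open import Data.Product using (Σ; Σ-syntax; ∃; _×_; _,_; proj₁)
open import Data.Sum using (_⊎_)
open import Data.Unit using (⊤)
import Data.Empty
import Data.Product
open import Data.List using (List; []; _∷_; length; map; concatMap; take; reverse)
open import Data.List.Membership.Propositional using (_∈_)
open import Data.List.Relation.Unary.All using (All)
open import Data.List.Relation.Unary.Unique.Propositional using (Unique)
open import Relation.Binary.Construct.Closure.ReflexiveTransitive using (Star)
open import Relation.Binary.PropositionalEquality using (_≡_)
open import Relation.Nullary using (¬_)
open import Function.Bundles using (_⇔_)

-- An edge of K_n: an unordered pair {u,v} with u ≠ v, stored normalised as u < v.
Edge : ℕ → Set
Edge n = Σ[ u ∈ Fin n ] Σ[ v ∈ Fin n ] u Fin.< v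

Graph : ℕ → Set
Graph n = List (Edge n)

module _ {n : ℕ} where

  Adj : Graph n → Fin n → Fin n → Set
  Adj es u v = (∃ λ (p : u Fin.< v) → (u , v , p) ∈ es) ⊎ (∃ λ (p : v Fin.< u) → (v , u , p) ∈ es)

  Conn : Graph n → Fin n → Fin n → Set
  Conn es = Star (Adj es)

  VSet : Set₁
  VSet = Fin n → Set

  Comp : Graph n → Fin n → VSet
  Comp es a v = Conn es a v

  IsTriangle : Graph n → Fin n × Fin n × Fin n → Set
  IsTriangle es (x , y , z) = Adj es x y × Adj es y z × Adj es x z

  triVerts : List (Fin n × Fin n × Fin n) → List (Fin n)
  triVerts ts = concatMap (λ { (x , y , z) → x ∷ y ∷ z ∷ [] }) ts

  HasTriangleFactorOn : Graph n → VSet → Set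
  HasTriangleFactorOn es S =
    ∃ λ (ts : List (Fin n × Fin n × Fin n)) →
      All (IsTriangle es) ts × Unique (triVerts ts) × (∀ v → (v ∈ triVerts ts) ⇔ S v)

  HasTriangleFactor : Graph n → Set
  HasTriangleFactor es = HasTriangleFactorOn es (λ _ → ⊤)

  VertexCount : VSet → ℕ → Set
  VertexCount S k = ∃ λ (xs : List (Fin n)) → Unique xs × (∀ v → (v ∈ xs) ⇔ S v) × length xs ≡ k

  EdgeCount : Graph n → VSet → ℕ → Set
  EdgeCount es S k =
    ∃ λ (fs : List (Edge n)) → Unique fs
      × (∀ e → (e ∈ fs) ⇔ ((e ∈ es) × S (proj₁ e) × S (proj₁ (Data.Product.proj₂ e))))
      × length fs ≡ k

  -- condition of rule (3): the component K has a triangle factor and |E(K)| = 4/3 |V(K)| - 1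
  DeclareCond : Graph n → VSet → Set
  DeclareCond es K = HasTriangleFactorOn es K ×
    (∃ λ v → ∃ λ e → VertexCount K v × EdgeCount es K e × 3 * e + 3 ≡ 4 * v)

  _∪_ : VSet → VSet → VSet
  (A ∪ B) v = A v ⊎ B v

  -- The good/bad status process.  'GoodTrace es G d' : after Client has claimed the
  -- edges es (listed NEWEST FIRST), the union of the vertex sets of the good components
  -- is G, and d components have been declared good so far.
  data GoodTrace : Graph n → VSet → ℕ → Set₁ where
    start : GoodTrace [] (λ _ → Data.Empty.⊥) 0
    ruleGood : ∀ {es G d a b} (p : a Fin.< b) →
      (G a ⊎ G b) →
      GoodTrace es G d →
      GoodTrace ((a , b , p) ∷ es) (G ∪ Comp ((a , b , p) ∷ es) a) d
    ruleDeclare : ∀ {es G d a b} (p : a Fin.< b) →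
      ¬ G a → ¬ G b →
      DeclareCond ((a , b , p) ∷ es) (Comp ((a , b , p) ∷ es) a) →
      GoodTrace es G d →
      GoodTrace ((a , b , p) ∷ es) (G ∪ Comp ((a , b , p) ∷ es) a) (suc d)
    ruleBad : ∀ {es G d a b} (p : a Fin.< b) →
      ¬ G a → ¬ G b →
      ¬ DeclareCond ((a , b , p) ∷ es) (Comp ((a , b , p) ∷ es) a) →
      GoodTrace es G d →
      GoodTrace ((a , b , p) ∷ es) G d

-- A round: (edge chosen by Client , edge given to Waiter)
Round : ℕ → Set
Round n = Edge n × Edge n

-- all offered edges are distinct (each round offers two yet unclaimed edges)
ValidPlay : ∀ {n} → List (Round n) → Set
ValidPlay rs = Unique (concatMap (λ { (c , w) → c ∷ w ∷ [] }) rs)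

-- Client's graph (chronological order)
clientEdges : ∀ {n} → List (Round n) → Graph n
clientEdges rs = map proj₁ rs

WaiterWon : ∀ {n} → List (Round n) → Set
WaiterWon rs = HasTriangleFactor (clientEdges rs)
  × (∀ k → k < length rs → ¬ HasTriangleFactor (clientEdges (take k rs)))

{-# OPTIONS --safe #-}
module Submission where

-- Let H be Client's final graph, T a triangle factor of H (so |T| = n/3), and R the list of
-- vertices at which components were declared good; every good vertex is connected to R.
-- A connected component K of H is a union of t(K) triangles of T, and adding its triangles one
-- at a time, each joined to the previous ones by an edge, shows |E(K)| ≥ 3t(K) + t(K) − 1.
-- If K contains no vertex of R, look at the newest edge of H inside K: when Client claimed it,
-- K was already a component of his graph with all its edges and a triangle factor, and it did
-- not become good, so rule (3) failed and |E(K)| ≠ 4t(K) − 1.  Hence |E(K)| ≥ 4t(K) − |R ∩ K|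
-- for every K, and summing, 4n/3 ≤ |E(H)| + d; with 6d ≤ n this gives |E(H)| ≥ 7n/6.

open import Defs
open import Data.Bool using (Bool; true; false; T; _∧_; _∨_; not)
open import Data.Bool.Properties using (T-≡; ∧-comm; ∧-identityʳ; ∧-zeroʳ; ⇔→≡; ¬-not)
import Data.Bool as Bool
open import Data.Empty using (⊥; ⊥-elim)
open import Data.Fin as Fin using (Fin)
open import Data.List using (List; []; _∷_; _++_; length; filterᵇ; concatMap; reverse)
open import Data.List.Properties
  using (length-filter; filter-++; length-++; filter-none; filter-all; filter-some; length-reverse; length-tabulate)
open import Data.List.Membership.Propositional using (_∈_; find; lose)
open import Data.List.Membership.Propositional.Properties
  using (∈-filter⁺; ∈-filter⁻; ∈-++⁺ʳ; ∈-++⁻; ∈-++⁺ˡ; ∈-∃++; ∈-concat⁺′; ∈-concat⁻′; ∈-map⁺; ∈-map⁻)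
import Data.List.Membership.DecPropositional as DecMembership
open import Data.List.Relation.Binary.Disjoint.Propositional using (Disjoint)
import Data.List.Relation.Binary.Permutation.Setoid as Permutation
import Data.List.Relation.Binary.Permutation.Setoid.Properties as PermutationProperties
open import Data.List.Relation.Unary.All as All using (All; []; _∷_)
import Data.List.Relation.Unary.All.Properties as All
open import Data.List.Relation.Unary.AllPairs as AllPairs using (AllPairs; []; _∷_)
import Data.List.Relation.Unary.AllPairs.Properties as AllPairs
open import Data.List.Relation.Unary.Any as Any using (Any; here; there)
import Data.List.Relation.Unary.Any.Properties as Any
open import Data.List.Relation.Unary.Unique.Propositional using (Unique)
import Data.List.Relation.Unary.Unique.Propositional.Properties as Unique
open import Data.Nat using (ℕ; zero; suc; _+_; _*_; _≤_; _<_; z≤n; s≤s; _≤?_)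
open import Data.Nat.Divisibility using (_∣_)
open import Data.Nat.Properties
open import Algebra.Properties.CommutativeSemigroup +-commutativeSemigroup using () renaming (interchange to +-interchange)
open import Data.Nat.Solver using (module +-*-Solver)
open import Data.Product using (∃; ∃₂; ∃-syntax; Σ-syntax; _×_; _,_; proj₁; proj₂)
import Data.Product as Product
open import Data.Sum using (_⊎_; inj₁; inj₂; [_,_]′)
import Data.Sum as Sum
open import Data.Unit using (tt)
open import Function using (_∘_; id)
open import Function.Bundles using (Equivalence; _⇔_; mk⇔)
open import Relation.Binary.Construct.Closure.ReflexiveTransitive as Star using (ε; _◅_; _◅◅_)
open import Relation.Binary.PropositionalEquality
open import Relation.Nullary using (¬_; yes; no; does; proof; contradiction)
open import Relation.Nullary.Decidable using (T?; dec-true)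
open import Relation.Nullary.Reflects using (Reflects; invert)
open import Relation.Unary using (Decidable)

∨-∧-same : ∀ a b c → (a ∨ b) ∧ (a ∨ c) ≡ (a ∧ a) ∨ (b ∧ c)
∨-∧-same true  _ _ = refl
∨-∧-same false _ _ = refl

∧-true⁻ : ∀ a {b} → a ∧ b ≡ true → a ≡ true × b ≡ true
∧-true⁻ true eq = refl , eq

∨-∧-not-split : ∀ a b → (a ≡ true → b ≡ true) → b ≡ a ∨ (b ∧ not a)
∨-∧-not-split true  true  _   = refl
∨-∧-not-split true  false a⇒b = a⇒b refl
∨-∧-not-split false b     _   = sym (∧-identityʳ b)

∧-∨-mono : ∀ a b {c d} → a ∧ b ≡ true → (a ∨ c) ∧ (b ∨ d) ≡ true
∧-∨-mono true true _ = refl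

∨-true⁻ : ∀ a {b} → a ∨ b ≡ true → a ≡ true ⊎ b ≡ true
∨-true⁻ true  _  = inj₁ refl
∨-true⁻ false eq = inj₂ eq

-- The greedy loops below terminate because a count bounded by `total` strictly increases.
fuel-step : ∀ {total m m′} k → total ≤ m + suc k → suc m ≤ m′ → total ≤ m′ + k
fuel-step {m = m} k fuel m<m′ = ≤-trans fuel (≤-trans (≤-reflexive (+-suc m k)) (+-monoˡ-≤ k m<m′))

fuel-exhausted : ∀ {total m m′} → total ≤ m + 0 → suc m ≤ m′ → m′ ≤ total → ⊥
fuel-exhausted {m = m} fuel m<m′ m′≤total =
  1+n≰n (≤-trans m<m′ (≤-trans m′≤total (≤-trans fuel (≤-reflexive (+-identityʳ m)))))

module _ {A : Set} where

  count : (A → Bool) → List A → ℕ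
  count f xs = length (filterᵇ f xs)

  ∈-filterᵇ⁺ : ∀ (f : A → Bool) {xs x} → x ∈ xs → f x ≡ true → x ∈ filterᵇ f xs
  ∈-filterᵇ⁺ f x∈xs fx = ∈-filter⁺ (λ y → T? (f y)) x∈xs (Equivalence.from T-≡ fx)

  ∈-filterᵇ⁻ : ∀ (f : A → Bool) {xs x} → x ∈ filterᵇ f xs → x ∈ xs × f x ≡ true
  ∈-filterᵇ⁻ f x∈ = Product.map₂ (Equivalence.to T-≡) (∈-filter⁻ (λ y → T? (f y)) x∈)

  count≤length : ∀ (f : A → Bool) xs → count f xs ≤ length xs
  count≤length f = length-filter (λ y → T? (f y))

  count-++ : ∀ (f : A → Bool) xs ys → count f (xs ++ ys) ≡ count f xs + count f ys
  count-++ f xs ys = trans (cong length (filter-++ (λ y → T? (f y)) xs ys)) (length-++ (filterᵇ f xs))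

  count-none : ∀ (f : A → Bool) xs → (∀ {x} → x ∈ xs → f x ≡ false) → count f xs ≡ 0
  count-none f _ h = cong length (filter-none (λ y → T? (f y)) (All.tabulate λ x∈ → subst T (h x∈)))

  count-all : ∀ (f : A → Bool) xs → (∀ {x} → x ∈ xs → f x ≡ true) → count f xs ≡ length xs
  count-all f _ h = cong length (filter-all (λ y → T? (f y)) (All.tabulate λ x∈ → Equivalence.from T-≡ (h x∈)))

  count-pos : ∀ (f : A → Bool) {xs x} → x ∈ xs → f x ≡ true → 0 < count f xs
  count-pos f x∈ fx = filter-some (λ y → T? (f y)) (Any.map (λ { refl → Equivalence.from T-≡ fx }) x∈)

  count≡0⇒false : ∀ (f : A → Bool) {xs x} → count f xs ≡ 0 → x ∈ xs → f x ≡ false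
  count≡0⇒false f {x ∷ xs} c0 (here refl) with f x
  ... | false = refl
  count≡0⇒false f {y ∷ xs} c0 (there x∈) with f y
  ... | false = count≡0⇒false f c0 x∈

  count-cong : ∀ (f g : A → Bool) xs → (∀ {x} → x ∈ xs → f x ≡ g x) → count f xs ≡ count g xs
  count-cong f g []       h = refl
  count-cong f g (x ∷ xs) h with f x | g x | h (here refl)
  ... | true  | true  | refl = cong suc (count-cong f g xs (h ∘ there))
  ... | false | false | refl = count-cong f g xs (h ∘ there)

  count-∨ : ∀ (f g : A → Bool) xs → (∀ {x} → x ∈ xs → f x ≡ true → g x ≡ false) →
            count (λ x → f x ∨ g x) xs ≡ count f xs + count g xs
  count-∨ f g []       h = refl
  count-∨ f g (x ∷ xs) h with f x in fx | g x in gx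
  ... | true  | true  = contradiction (trans (sym gx) (h (here refl) fx)) λ ()
  ... | true  | false = cong suc (count-∨ f g xs (h ∘ there))
  ... | false | true  = trans (cong suc (count-∨ f g xs (h ∘ there))) (sym (+-suc _ _))
  ... | false | false = count-∨ f g xs (h ∘ there)

  count≤1 : ∀ (f : A → Bool) {xs} → Unique xs → (∀ {x y} → x ∈ xs → y ∈ xs → f x ≡ true → f y ≡ true → x ≡ y) →
            count f xs ≤ 1
  count≤1 f {[]} _ _ = z≤n
  count≤1 f {x ∷ xs} (x∉xs ∷ u) h with f x in fx
  ... | true  = ≤-reflexive (cong suc (count-none f xs others))
    where
    others : ∀ {y} → y ∈ xs → f y ≡ false
    others {y} y∈ with f y in fy
    ... | true  = contradiction (h (here refl) (there y∈) fx fy) (All.lookup x∉xs y∈)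
    ... | false = refl
  ... | false = count≤1 f u λ x∈ y∈ → h (there x∈) (there y∈)

  ∈-delete : ∀ ys₁ {ys₂ : List A} {x y} → y ∈ ys₁ ++ x ∷ ys₂ → x ≢ y → y ∈ ys₁ ++ ys₂
  ∈-delete ys₁ y∈ x≢y with ∈-++⁻ ys₁ y∈
  ... | inj₁ y∈ys₁         = ∈-++⁺ˡ y∈ys₁
  ... | inj₂ (here refl)   = contradiction refl x≢y
  ... | inj₂ (there y∈ys₂) = ∈-++⁺ʳ ys₁ y∈ys₂

  unique-⊆⇒length≤ : ∀ {xs ys : List A} → Unique xs → (∀ {x} → x ∈ xs → x ∈ ys) → length xs ≤ length ys
  unique-⊆⇒length≤ {[]} _ _ = z≤n
  unique-⊆⇒length≤ {x ∷ xs} (x∉xs ∷ u) xs⊆ys with ys₁ , ys₂ , refl ← ∈-∃++ (xs⊆ys (here refl)) = begin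
    suc (length xs)               ≤⟨ s≤s (unique-⊆⇒length≤ u xs⊆ys₁++ys₂) ⟩
    suc (length (ys₁ ++ ys₂))     ≡⟨ cong suc (length-++ ys₁) ⟩
    suc (length ys₁ + length ys₂) ≡⟨ +-suc (length ys₁) (length ys₂) ⟨
    length ys₁ + length (x ∷ ys₂) ≡⟨ length-++ ys₁ ⟨
    length (ys₁ ++ x ∷ ys₂)       ∎
    where
    open ≤-Reasoning
    xs⊆ys₁++ys₂ : ∀ {y} → y ∈ xs → y ∈ ys₁ ++ ys₂
    xs⊆ys₁++ys₂ y∈ = ∈-delete ys₁ (xs⊆ys (there y∈)) (All.lookup x∉xs y∈)

all⊎counterexample : ∀ {A : Set} {P : A → Set} → Decidable P → ∀ xs → All P xs ⊎ ∃[ x ] x ∈ xs × ¬ P x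
all⊎counterexample P? xs with All.all? P? xs
... | yes all = inj₁ all
... | no ¬all = inj₂ (find (All.¬All⇒Any¬ P? xs ¬all))

AllPairs-∈ : ∀ {A : Set} {R : A → A → Set} {xs x y} → AllPairs R xs → x ∈ xs → y ∈ xs → x ≡ y ⊎ R x y ⊎ R y x
AllPairs-∈ _              (here refl) (here refl) = inj₁ refl
AllPairs-∈ (x∼xs ∷ _)     (here refl) (there y∈)  = inj₂ (inj₁ (All.lookup x∼xs y∈))
AllPairs-∈ (y∼xs ∷ _)     (there x∈)  (here refl) = inj₂ (inj₂ (All.lookup y∼xs x∈))
AllPairs-∈ (_ ∷ pairs)    (there x∈)  (there y∈)  = AllPairs-∈ pairs x∈ y∈

unique-++⁻ : ∀ {A : Set} (xs : List A) {ys} → Unique (xs ++ ys) → Unique xs × Unique ys × Disjoint xs ys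
unique-++⁻ [] u = [] , u , λ ()
unique-++⁻ (x ∷ xs) (x∉ ∷ u) with uxs , uys , disjoint ← unique-++⁻ xs u =
  All.tabulate (All.lookup x∉ ∘ ∈-++⁺ˡ) ∷ uxs , uys ,
  λ { (here refl , y∈ys) → All.lookup x∉ (∈-++⁺ʳ xs y∈ys) refl ; (there y∈xs , y∈ys) → disjoint (y∈xs , y∈ys) }

unique-concatMap⁻ : ∀ {A B : Set} (f : A → List B) xs → Unique (concatMap f xs) →
                    All (Unique ∘ f) xs × AllPairs (λ x y → Disjoint (f x) (f y)) xs
unique-concatMap⁻ f [] _ = [] , []
unique-concatMap⁻ f (x ∷ xs) u
  with ufx , urest , disjoint ← unique-++⁻ (f x) u
  with us , disjoints ← unique-concatMap⁻ f xs urest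
  = ufx ∷ us , All.tabulate (λ y∈ (v∈fx , v∈fy) → disjoint (v∈fx , ∈-concat⁺′ v∈fy (∈-map⁺ f y∈))) ∷ disjoints

unique-concatMap⁺ : ∀ {A B : Set} (f : A → List B) {xs} → All (Unique ∘ f) xs →
                    AllPairs (λ x y → Disjoint (f x) (f y)) xs → Unique (concatMap f xs)
unique-concatMap⁺ f us disjoints = Unique.concat⁺ (All.map⁺ us) (AllPairs.map⁺ disjoints)

unique-reverse : ∀ {A : Set} {xs : List A} → Unique xs → Unique (reverse xs)
unique-reverse {A} {xs} = Unique-resp-↭ (↭-sym (↭-reverse xs))
  where
  open PermutationProperties (setoid A) using (Unique-resp-↭; ↭-reverse)
  open Permutation (setoid A) using (↭-sym)

-- Graphs, vertex sets and triangles

module _ {n : ℕ} where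

  private variable
    es fs : Graph n
    e : Edge n
    u v u′ v′ : Fin n

  lower upper : Edge n → Fin n
  lower = proj₁
  upper = proj₁ ∘ proj₂

  data Joins (e : Edge n) : Fin n → Fin n → Set where
    forward  : Joins e (lower e) (upper e)
    backward : Joins e (upper e) (lower e)

  joins-unique : Joins e u v → Joins e u′ v′ → (u ≡ u′ × v ≡ v′) ⊎ (u ≡ v′ × v ≡ u′)
  joins-unique forward  forward  = inj₁ (refl , refl)
  joins-unique forward  backward = inj₂ (refl , refl)
  joins-unique backward forward  = inj₂ (refl , refl)
  joins-unique backward backward = inj₁ (refl , refl)

  adj⇒edge : Adj es u v → ∃[ e ] e ∈ es × Joins e u v
  adj⇒edge (inj₁ (_ , e∈)) = _ , e∈ , forward
  adj⇒edge (inj₂ (_ , e∈)) = _ , e∈ , backward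

  edge⇒adj : e ∈ es → Joins e u v → Adj es u v
  edge⇒adj e∈ forward  = inj₁ (_ , e∈)
  edge⇒adj e∈ backward = inj₂ (_ , e∈)

  adj-sym : Adj es u v → Adj es v u
  adj-sym = Sum.swap

  conn-sym : Conn es u v → Conn es v u
  conn-sym = Star.reverse adj-sym

  adj-mono : (∀ {e} → e ∈ es → e ∈ fs) → Adj es u v → Adj fs u v
  adj-mono es⊆fs = Sum.map (Product.map₂ es⊆fs) (Product.map₂ es⊆fs)

  conn-mono : (∀ {e} → e ∈ es → e ∈ fs) → Conn es u v → Conn fs u v
  conn-mono es⊆fs = Star.map (adj-mono es⊆fs)

  VSetᵇ : Set
  VSetᵇ = Fin n → Bool

  ∅ᵇ : VSetᵇ
  ∅ᵇ _ = false

  _∪ᵇ_ : VSetᵇ → VSetᵇ → VSetᵇ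
  (S ∪ᵇ S′) v = S v ∨ S′ v

  both : VSetᵇ → Edge n → Bool
  both S e = S (lower e) ∧ S (upper e)

  both-joins : ∀ S → Joins e u v → both S e ≡ S u ∧ S v
  both-joins S forward            = refl
  both-joins {e = e} S backward = ∧-comm (S (lower e)) (S (upper e))

  Closed : VSetᵇ → Graph n → Set
  Closed S es = ∀ {e} → e ∈ es → S (lower e) ≡ S (upper e)

  closed-adj : ∀ {S} → Closed S es → Adj es u v → S u ≡ S v
  closed-adj closed (inj₁ (_ , e∈)) = closed e∈
  closed-adj closed (inj₂ (_ , e∈)) = sym (closed e∈)

  closed-conn : ∀ {S} → Closed S es → Conn es u v → S u ≡ S v
  closed-conn {S = S} closed = Star.fold (λ u v → S u ≡ S v) (λ a eq → trans (closed-adj closed a) eq) refl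

  closed⊎crossing : ∀ S es → Closed S es ⊎ ∃₂ λ x y → S x ≡ true × S y ≡ false × Adj es x y
  closed⊎crossing S es with all⊎counterexample (λ e → S (lower e) Bool.≟ S (upper e)) es
  ... | inj₁ all = inj₁ (All.lookup all)
  ... | inj₂ ((u , v , p) , e∈ , S≢) with S u in Su | S v in Sv
  ...   | true  | false = inj₂ (u , v , Su , Sv , inj₁ (p , e∈))
  ...   | false | true  = inj₂ (v , u , Sv , Su , inj₂ (p , e∈))
  ...   | true  | true  = contradiction refl S≢
  ...   | false | false = contradiction refl S≢

  Triangle : Set
  Triangle = Fin n × Fin n × Fin n

  apex : Triangle → Fin n
  apex = proj₁

  -- triVerts ts is definitionally concatMap corners ts.
  corners : Triangle → List (Fin n)
  corners (x , y , z) = x ∷ y ∷ z ∷ []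

  open DecMembership (Fin._≟_ {n}) using (_∈?_)

  cornerᵇ : Triangle → VSetᵇ
  cornerᵇ t u = does (u ∈? corners t)

  private variable
    t : Triangle

  cornerᵇ-complete : ∀ t → u ∈ corners t → cornerᵇ t u ≡ true
  cornerᵇ-complete {u} t = dec-true (u ∈? corners t)

  cornerᵇ-sound : ∀ t → cornerᵇ t u ≡ true → u ∈ corners t
  cornerᵇ-sound {u} t eq = invert (subst (Reflects (u ∈ corners t)) eq (proof (u ∈? corners t)))

  ∈-triVerts⁺ : ∀ {ts : List Triangle} → t ∈ ts → u ∈ corners t → u ∈ triVerts ts
  ∈-triVerts⁺ t∈ u∈ = ∈-concat⁺′ u∈ (∈-map⁺ corners t∈)

  ∈-triVerts⁻ : ∀ (ts : List Triangle) → u ∈ triVerts ts → ∃[ t ] t ∈ ts × u ∈ corners t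
  ∈-triVerts⁻ ts u∈ with cs , u∈cs , cs∈ ← ∈-concat⁻′ (Data.List.map corners ts) u∈
                   with t , t∈ , refl ← ∈-map⁻ corners cs∈ = t , t∈ , u∈cs

  length-triVerts : ∀ (ts : List Triangle) → length (triVerts ts) ≡ 3 * length ts
  length-triVerts []       = refl
  length-triVerts (t ∷ ts) = trans (cong (3 +_) (length-triVerts ts)) (sym (*-suc 3 (length ts)))

  spanning⇒n≤3*length : ∀ (ts : List Triangle) → (∀ v → v ∈ triVerts ts) → n ≤ 3 * length ts
  spanning⇒n≤3*length ts spanning = subst₂ _≤_ (length-tabulate id) (length-triVerts ts)
    (unique-⊆⇒length≤ (Unique.allFin⁺ n) λ {v} _ → spanning v)

  apex-conn : IsTriangle es t → u ∈ corners t → Conn es (apex t) u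
  apex-conn _            (here refl)                 = ε
  apex-conn (xy , _ , _) (there (here refl))         = xy ◅ ε
  apex-conn (_ , _ , xz) (there (there (here refl))) = xz ◅ ε

  isTriangle-mono : (∀ {e} → e ∈ es → e ∈ fs) → IsTriangle es t → IsTriangle fs t
  isTriangle-mono es⊆fs (xy , yz , xz) = adj-mono es⊆fs xy , adj-mono es⊆fs yz , adj-mono es⊆fs xz

  corners-conn : IsTriangle es t → u ∈ corners t → v ∈ corners t → Conn es u v
  corners-conn tri u∈ v∈ = conn-sym (apex-conn tri u∈) ◅◅ apex-conn tri v∈

  record Within (t : Triangle) (e : Edge n) : Set where
    constructor _,_
    field
      lower∈ : lower e ∈ corners t
      upper∈ : upper e ∈ corners t

  joins-within : Joins e u v → Within t e → u ∈ corners t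
  joins-within forward  = Within.lower∈
  joins-within backward = Within.upper∈

  within-joins : Joins e u v → u ∈ corners t → v ∈ corners t → Within t e
  within-joins forward  u∈ v∈ = u∈ , v∈
  within-joins backward u∈ v∈ = v∈ , u∈

  triangleEdges : IsTriangle es t → Unique (corners t) →
                  ∃[ fs ] length fs ≡ 3 × Unique fs × All (λ f → f ∈ es × Within t f) fs
  triangleEdges {t = x , y , z} (xy , yz , xz) ((x≢y ∷ x≢z ∷ []) ∷ (y≢z ∷ []) ∷ [] ∷ [])
    with exy , exy∈ , jxy ← adj⇒edge xy
       | eyz , eyz∈ , jyz ← adj⇒edge yz
       | exz , exz∈ , jxz ← adj⇒edge xz
    = exy ∷ eyz ∷ exz ∷ [] , refl
    , ((exy≢eyz ∷ exy≢exz ∷ []) ∷ (eyz≢exz ∷ []) ∷ [] ∷ [])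
    , (exy∈ , within-joins jxy x∈ y∈) ∷ (eyz∈ , within-joins jyz y∈ z∈) ∷ (exz∈ , within-joins jxz x∈ z∈) ∷ []
    where
    x∈ : x ∈ corners (x , y , z)
    x∈ = here refl
    y∈ : y ∈ corners (x , y , z)
    y∈ = there (here refl)
    z∈ : z ∈ corners (x , y , z)
    z∈ = there (there (here refl))
    exy≢eyz : exy ≢ eyz
    exy≢eyz refl = [ (λ eqs → x≢y (proj₁ eqs)) , (λ eqs → x≢z (proj₁ eqs)) ]′ (joins-unique jxy jyz)
    exy≢exz : exy ≢ exz
    exy≢exz refl = [ (λ eqs → y≢z (proj₂ eqs)) , (λ eqs → x≢z (proj₁ eqs)) ]′ (joins-unique jxy jxz)
    eyz≢exz : eyz ≢ exz
    eyz≢exz refl = [ (λ eqs → x≢y (sym (proj₁ eqs))) , (λ eqs → y≢z (proj₁ eqs)) ]′ (joins-unique jyz jxz)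

module TriangleFactor {n : ℕ} {ts : List (Triangle {n})} (factor : Unique (triVerts ts)) where

  private variable
    s t : Triangle
    u : Fin n

  corners-unique : All (Unique ∘ corners) ts
  corners-unique = proj₁ (unique-concatMap⁻ corners ts factor)

  corners-disjoint : AllPairs (λ s t → Disjoint (corners s) (corners t)) ts
  corners-disjoint = proj₂ (unique-concatMap⁻ corners ts factor)

  shared-corner : s ∈ ts → t ∈ ts → u ∈ corners s → u ∈ corners t → s ≡ t
  shared-corner s∈ t∈ u∈s u∈t with AllPairs-∈ corners-disjoint s∈ t∈
  ... | inj₁ s≡t          = s≡t
  ... | inj₂ (inj₁ s⊥t)   = contradiction (u∈s , u∈t) s⊥t
  ... | inj₂ (inj₂ t⊥s)   = contradiction (u∈t , u∈s) t⊥s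

  unique-triangles : Unique ts
  unique-triangles = AllPairs.map (λ { s⊥t refl → s⊥t (here refl , here refl) }) corners-disjoint

  factor-filterᵇ : ∀ f → Unique (triVerts (filterᵇ f ts))
  factor-filterᵇ f = unique-concatMap⁺ corners
    (All.filter⁺ (λ t → T? (f t)) corners-unique) (AllPairs.filter⁺ (λ t → T? (f t)) corners-disjoint)

  cornerᵇ-saturated : t ∈ ts → s ∈ ts → u ∈ corners s → cornerᵇ t u ≡ cornerᵇ t (apex s)
  cornerᵇ-saturated {t} {s} {u} t∈ s∈ u∈s = ⇔→≡ (mk⇔
    (λ c → cornerᵇ-complete t (subst (λ r → apex s ∈ corners r) (s≡t u∈s c) (here refl)))
    (λ c → cornerᵇ-complete t (subst (λ r → u ∈ corners r) (s≡t (here refl) c) u∈s)))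
    where
    s≡t : ∀ {w} → w ∈ corners s → cornerᵇ t w ≡ true → s ≡ t
    s≡t w∈s c = shared-corner s∈ t∈ w∈s (cornerᵇ-sound t c)

-- The good/bad trace

module _ {n : ℕ} where

  private variable
    es : Graph n
    G G′ : VSet {n}
    d : ℕ
    e : Edge n
    v : Fin n

  Rooted : List (Fin n) → Graph n → VSet {n} → Set
  Rooted R es G = ∀ {v} → G v → ∃[ r ] r ∈ R × Conn es r v

  rooted-∷ : ∀ {R} → Rooted R es G → Rooted R (e ∷ es) G
  rooted-∷ rooted Gv with r , r∈ , r⇝v ← rooted Gv = r , r∈ , conn-mono there r⇝v

  declaredRoots : GoodTrace es G d → ∃[ R ] length R ≡ d × Rooted R es G
  declaredRoots start = [] , refl , λ ()
  declaredRoots (ruleGood {G = G} {a = a} {b} p a∨b tr) with R , refl , rooted ← declaredRoots tr = R , refl , rooted′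
    where
    through : ∀ {u} → G u → Conn _ u v → ∃[ r ] r ∈ R × Conn _ r v
    through Gu u⇝v with r , r∈ , r⇝u ← rooted-∷ rooted Gu = r , r∈ , r⇝u ◅◅ u⇝v
    rooted′ : Rooted R _ _
    rooted′ (inj₁ Gv)              = rooted-∷ rooted Gv
    rooted′ (inj₂ a⇝v) = [ (λ Ga → through Ga a⇝v) , (λ Gb → through Gb (inj₂ (p , here refl) ◅ a⇝v)) ]′ a∨b
  declaredRoots (ruleDeclare {a = a} _ _ _ _ tr) with R , refl , rooted ← declaredRoots tr = a ∷ R , refl , rooted′
    where
    rooted′ : Rooted (a ∷ R) _ _
    rooted′ (inj₁ Gv)  = let r , r∈ , r⇝v = rooted-∷ rooted Gv in r , there r∈ , r⇝v
    rooted′ (inj₂ a⇝v) = a , here refl , a⇝v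
  declaredRoots (ruleBad _ _ _ _ tr) with R , refl , rooted ← declaredRoots tr = R , refl , rooted-∷ rooted

  record NewestEdge (Q : Edge n → Bool) (es : Graph n) (G : VSet {n}) : Set where
    field
      newer older    : Graph n
      edge           : Edge n
      split          : es ≡ newer ++ edge ∷ older
      newer-rejected : All (λ e → Q e ≡ false) newer
      accepted       : Q edge ≡ true
      outcome        : G (lower edge) ⊎ ¬ DeclareCond (edge ∷ older) (Comp (edge ∷ older) (lower edge))

  module _ (Q : Edge n → Bool) where

    open NewestEdge

    newestEdge : GoodTrace es G d → Any (λ e → Q e ≡ true) es → NewestEdge Q es G
    newestEdge-∷ : GoodTrace es G d → (∀ {v} → G v → G′ v) →
                   G′ (lower e) ⊎ ¬ DeclareCond (e ∷ es) (Comp (e ∷ es) (lower e)) →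
                   Any (λ e → Q e ≡ true) (e ∷ es) → NewestEdge Q (e ∷ es) G′

    newestEdge start ()
    newestEdge (ruleGood _ _ tr)             = newestEdge-∷ tr inj₁ (inj₁ (inj₂ ε))
    newestEdge (ruleDeclare _ _ _ _ tr)      = newestEdge-∷ tr inj₁ (inj₁ (inj₂ ε))
    newestEdge (ruleBad _ _ _ undeclared tr) = newestEdge-∷ tr id (inj₂ undeclared)

    newestEdge-∷ {e = e} tr G⊆G′ outcome′ any with Q e in Qe
    ... | true = record
      { newer = [] ; older = _ ; edge = e ; split = refl ; newer-rejected = [] ; accepted = Qe ; outcome = outcome′ }
    ... | false with any
    ...   | here Qe′   = contradiction (trans (sym Qe′) Qe) λ ()
    ...   | there any′ = let N = newestEdge tr any′ in record
      { newer = e ∷ newer N ; older = older N ; edge = edge N ; split = cong (e ∷_) (split N)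
      ; newer-rejected = Qe ∷ newer-rejected N ; accepted = accepted N ; outcome = Sum.map₁ G⊆G′ (outcome N) }

-- Components of a graph with a triangle factor

module Factor {n : ℕ} (H : Graph n) (ts : List Triangle) (triangles : All (IsTriangle H) ts)
               (factor : Unique (triVerts ts)) (spanning : ∀ v → v ∈ triVerts ts) where

  open TriangleFactor {ts = ts} factor

  private variable
    a u v x y : Fin n
    e : Edge n
    t : Triangle

  triangleOf : ∀ v → ∃[ t ] t ∈ ts × v ∈ corners t
  triangleOf v = ∈-triVerts⁻ ts (spanning v)

  Saturated : VSetᵇ → Set
  Saturated S = ∀ {t u} → t ∈ ts → u ∈ corners t → S u ≡ S (apex t)

  Connected : VSetᵇ → Set
  Connected S = ∀ {u v} → S u ≡ true → S v ≡ true → Conn H u v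

  -- A saturated set is a union of triangles of the factor, each counted once by its apex.
  trianglesIn edgesIn : VSetᵇ → ℕ
  trianglesIn S = count (S ∘ apex) ts
  edgesIn S     = count (both S) H

  trianglesIn-∅ : trianglesIn ∅ᵇ ≡ 0
  trianglesIn-∅ = count-none (∅ᵇ ∘ apex) ts λ _ → refl

  saturated-∪ᵇ : ∀ {S S′} → Saturated S → Saturated S′ → Saturated (S ∪ᵇ S′)
  saturated-∪ᵇ sat sat′ t∈ u∈ = cong₂ _∨_ (sat t∈ u∈) (sat′ t∈ u∈)

  module Extension (C : VSetᵇ) (C-saturated : Saturated C) {t} (t∈ : t ∈ ts) (t∉C : C (apex t) ≡ false) where

    C⁺ : VSetᵇ
    C⁺ = C ∪ᵇ cornerᵇ t

    triangle : IsTriangle H t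
    triangle = All.lookup triangles t∈

    corner∉C : u ∈ corners t → C u ≡ false
    corner∉C u∈ = trans (C-saturated t∈ u∈) t∉C

    C⇒¬corner : C u ≡ true → cornerᵇ t u ≡ false
    C⇒¬corner {u} Cu with cornerᵇ t u in c
    ... | false = refl
    ... | true  = contradiction (trans (sym Cu) (corner∉C (cornerᵇ-sound t c))) λ ()

    saturated⁺ : Saturated C⁺
    saturated⁺ = saturated-∪ᵇ C-saturated (cornerᵇ-saturated t∈)

    triangles⁺ : trianglesIn C⁺ ≡ suc (trianglesIn C)
    triangles⁺ = begin
      trianglesIn C⁺                                   ≡⟨ count-∨ (C ∘ apex) (cornerᵇ t ∘ apex) ts (λ _ → C⇒¬corner) ⟩
      trianglesIn C + count (cornerᵇ t ∘ apex) ts      ≡⟨ cong (trianglesIn C +_) just-t ⟩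
      trianglesIn C + 1                                ≡⟨ +-comm (trianglesIn C) 1 ⟩
      suc (trianglesIn C)                              ∎
      where
      open ≡-Reasoning
      is-t : ∀ {s} → s ∈ ts → cornerᵇ t (apex s) ≡ true → s ≡ t
      is-t s∈ c = shared-corner s∈ t∈ (here refl) (cornerᵇ-sound t c)
      just-t : count (cornerᵇ t ∘ apex) ts ≡ 1
      just-t = ≤-antisym
        (count≤1 _ unique-triangles λ r∈ s∈ cr cs → trans (is-t r∈ cr) (sym (is-t s∈ cs)))
        (count-pos (cornerᵇ t ∘ apex) t∈ (cornerᵇ-complete t (here refl)))

    newEdge : Edge n → Bool
    newEdge e = both C⁺ e ∧ not (both C e)

    edges⁺ : edgesIn C⁺ ≡ edgesIn C + count newEdge H
    edges⁺ = trans (count-cong (both C⁺) (λ e → both C e ∨ newEdge e) H λ {e} _ → split {e})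
                   (count-∨ (both C) newEdge H λ {e} _ → old-not-new {e})
      where
      split : both C⁺ e ≡ both C e ∨ newEdge e
      split {e} = ∨-∧-not-split (both C e) (both C⁺ e) (∧-∨-mono (C (lower e)) (C (upper e)))
      old-not-new : both C e ≡ true → newEdge e ≡ false
      old-not-new {e} old = trans (cong (λ b → both C⁺ e ∧ not b) old) (∧-zeroʳ _)

    newEdge-joins : Joins e u v → newEdge e ≡ ((C u ∨ cornerᵇ t u) ∧ (C v ∨ cornerᵇ t v)) ∧ not (C u ∧ C v)
    newEdge-joins j = cong₂ (λ p q → p ∧ not q) (both-joins C⁺ j) (both-joins C j)

    within-new : Within t e → newEdge e ≡ true
    within-new {e} (lo∈ , hi∈) rewrite newEdge-joins (forward {e = e})
      | corner∉C lo∈ | corner∉C hi∈ | cornerᵇ-complete t lo∈ | cornerᵇ-complete t hi∈ = refl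

    crossing-new : C x ≡ true → Joins e x y → y ∈ corners t → newEdge e ≡ true
    crossing-new Cx j y∈ rewrite newEdge-joins j | Cx | corner∉C y∈ | cornerᵇ-complete t y∈ = refl

    Fresh : Edge n → Set
    Fresh e = e ∈ H × newEdge e ≡ true × ¬ Within t e

    fresh+3≤new : ∀ {extra} → Unique extra → All Fresh extra → length extra + 3 ≤ count newEdge H
    fresh+3≤new {extra} unique-extra fresh
      with fs , length≡3 , unique-fs , fs-within ← triangleEdges triangle (All.lookup corners-unique t∈)
      = begin
        length extra + 3             ≡⟨ cong (length extra +_) length≡3 ⟨
        length extra + length fs     ≡⟨ length-++ extra ⟨
        length (extra ++ fs)         ≤⟨ unique-⊆⇒length≤ (Unique.++⁺ unique-extra unique-fs disjoint) ⊆new ⟩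
        count newEdge H              ∎
      where
      open ≤-Reasoning
      disjoint : Disjoint extra fs
      disjoint (e∈extra , e∈fs) = proj₂ (proj₂ (All.lookup fresh e∈extra)) (proj₂ (All.lookup fs-within e∈fs))
      ⊆new : ∀ {e} → e ∈ extra ++ fs → e ∈ filterᵇ newEdge H
      ⊆new e∈ with ∈-++⁻ extra e∈
      ... | inj₁ e∈extra = let e∈H , new , _ = All.lookup fresh e∈extra in ∈-filterᵇ⁺ newEdge e∈H new
      ... | inj₂ e∈fs    = let e∈H , within = All.lookup fs-within e∈fs in ∈-filterᵇ⁺ newEdge e∈H (within-new within)

    dense⁺ : ∀ {extra} → Unique extra → All Fresh extra →
             4 * trianglesIn C ≤ edgesIn C + length extra → 4 * trianglesIn C⁺ ≤ edgesIn C⁺ + 1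
    dense⁺ {extra} unique-extra fresh bound = begin
      4 * trianglesIn C⁺                 ≡⟨ cong (4 *_) triangles⁺ ⟩
      4 * suc (trianglesIn C)            ≡⟨ *-suc 4 (trianglesIn C) ⟩
      4 + 4 * trianglesIn C              ≤⟨ +-monoʳ-≤ 4 bound ⟩
      4 + (edgesIn C + length extra)     ≡⟨ solve 2 (λ E k → con 4 :+ (E :+ k) := E :+ (k :+ con 3) :+ con 1) refl
                                                  (edgesIn C) (length extra) ⟩
      edgesIn C + (length extra + 3) + 1 ≤⟨ +-monoˡ-≤ 1 (+-monoʳ-≤ (edgesIn C) (fresh+3≤new unique-extra fresh)) ⟩
      edgesIn C + count newEdge H + 1    ≡⟨ cong (_+ 1) edges⁺ ⟨
      edgesIn C⁺ + 1                     ∎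
      where
      open ≤-Reasoning
      open +-*-Solver

    crossing-fresh : C x ≡ true → Adj H x y → y ∈ corners t → ∃ Fresh
    crossing-fresh Cx xy y∈ with e , e∈ , j ← adj⇒edge xy =
      e , e∈ , crossing-new Cx j y∈ , λ within → contradiction (trans (sym Cx) (corner∉C (joins-within j within))) λ ()

    connected⁺ : Connected C → C x ≡ true → Adj H x y → y ∈ corners t → Connected C⁺
    connected⁺ connected Cx xy y∈ {u} {v} C⁺u C⁺v with ∨-true⁻ (C u) C⁺u | ∨-true⁻ (C v) C⁺v
    ... | inj₁ Cu | inj₁ Cv = connected Cu Cv
    ... | inj₁ Cu | inj₂ tv = connected Cu Cx ◅◅ xy ◅ corners-conn triangle y∈ (cornerᵇ-sound t tv)
    ... | inj₂ tu | inj₁ Cv = conn-sym (connected Cv Cx ◅◅ xy ◅ corners-conn triangle y∈ (cornerᵇ-sound t tu))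
    ... | inj₂ tu | inj₂ tv = corners-conn triangle (cornerᵇ-sound t tu) (cornerᵇ-sound t tv)

  record Cluster (a : Fin n) : Set where
    field
      members   : VSetᵇ
      saturated : Saturated members
      connected : Connected members
      ∋a        : members a ≡ true
      dense     : 4 * trianglesIn members ≤ edgesIn members + 1

  open Cluster

  seed : ∀ a → Cluster a
  seed a with t , t∈ , a∈t ← triangleOf a = record
    { members   = C⁺
    ; saturated = saturated⁺
    ; connected = λ Cu Cv → corners-conn triangle (cornerᵇ-sound t Cu) (cornerᵇ-sound t Cv)
    ; ∋a        = cornerᵇ-complete t a∈t
    ; dense     = dense⁺ [] [] (subst (λ k → 4 * k ≤ edgesIn ∅ᵇ + 0) (sym trianglesIn-∅) z≤n)
    }
    where open Extension ∅ᵇ (λ _ _ → refl) t∈ refl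

  grow : (K : Cluster a) → members K x ≡ true → members K y ≡ false → Adj H x y →
         ∃[ K⁺ ] trianglesIn (members K⁺) ≡ suc (trianglesIn (members K))
  grow {a} {x} {y} K Kx Ky xy with t , t∈ , y∈t ← triangleOf y = record
    { members   = C⁺
    ; saturated = saturated⁺
    ; connected = connected⁺ (connected K) Kx xy y∈t
    ; ∋a        = cong (_∨ cornerᵇ t a) (∋a K)
    ; dense     = dense⁺ ([] ∷ []) (proj₂ (crossing-fresh Kx xy y∈t) ∷ []) (dense K)
    } , triangles⁺
    where open Extension (members K) (saturated K) t∈ (trans (sym (saturated K t∈ y∈t)) Ky)

  Component : Fin n → Set
  Component a = Σ[ K ∈ Cluster a ] Closed (members K) H

  component : ∀ a → Component a
  component a = close (length ts) (seed a) (m≤n+m (length ts) _)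
    where
    close : ∀ k (K : Cluster a) → length ts ≤ trianglesIn (members K) + k → Component a
    close k K fuel with closed⊎crossing (members K) H
    ... | inj₁ closed = K , closed
    ... | inj₂ (x , y , Kx , Ky , xy) with grow K Kx Ky xy | k
    ...   | K⁺ , growth | zero   = ⊥-elim (fuel-exhausted fuel (≤-reflexive (sym growth)) (count≤length _ ts))
    ...   | K⁺ , growth | suc k′ = close k′ K⁺ (fuel-step k′ fuel (≤-reflexive (sym growth)))

  module Game {G : VSet {n}} {d} (trace : GoodTrace H G d) (unique-H : Unique H) where

    roots : List (Fin n)
    roots = proj₁ (declaredRoots trace)

    rooted : Rooted roots H G
    rooted = proj₂ (proj₂ (declaredRoots trace))

    rootsIn : VSetᵇ → ℕ
    rootsIn S = count S roots

    module Declaration (K : Cluster a) (K-closed : Closed (members K) H)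
                       (N : NewestEdge (both (members K)) H G) where

      open NewestEdge N

      S : VSetᵇ
      S = members K

      H′ : Graph n
      H′ = edge ∷ older

      H′⊆H : e ∈ H′ → e ∈ H
      H′⊆H e∈ = subst (_ ∈_) (sym split) (∈-++⁺ʳ newer e∈)

      inside⇒H′ : e ∈ H → both S e ≡ true → e ∈ H′
      inside⇒H′ e∈ inside with ∈-++⁻ newer (subst (_ ∈_) split e∈)
      ... | inj₁ e∈newer = contradiction (trans (sym inside) (All.lookup newer-rejected e∈newer)) λ ()
      ... | inj₂ e∈H′    = e∈H′

      adj-H′ : Adj H u v → S u ≡ true → S v ≡ true → Adj H′ u v
      adj-H′ uv Su Sv with e , e∈ , j ← adj⇒edge uv =
        edge⇒adj (inside⇒H′ e∈ (trans (both-joins S j) (cong₂ _∧_ Su Sv))) j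

      conn-H′ : Conn H u v → S u ≡ true → Conn H′ u v
      conn-H′ ε         Su = ε
      conn-H′ (uw ◅ w⇝v) Su = adj-H′ uw Su Sw ◅ conn-H′ w⇝v Sw
        where Sw = trans (sym (closed-adj K-closed uw)) Su

      x₀ : Fin n
      x₀ = lower edge

      Sx₀ : S x₀ ≡ true
      Sx₀ = proj₁ (∧-true⁻ (S x₀) accepted)

      comp⇒ : Comp H′ x₀ v → S v ≡ true
      comp⇒ x⇝v = trans (sym (closed-conn K-closed (conn-mono H′⊆H x⇝v))) Sx₀

      comp⇐ : S v ≡ true → Comp H′ x₀ v
      comp⇐ Sv = conn-H′ (connected K Sx₀ Sv) Sx₀

      ts′ : List Triangle
      ts′ = filterᵇ (S ∘ apex) ts

      corner⇔ : ∀ v → (v ∈ triVerts ts′) ⇔ Comp H′ x₀ v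
      corner⇔ v = mk⇔
        (λ v∈ → let t , t∈′ , v∈t = ∈-triVerts⁻ ts′ v∈ ; t∈ , St = ∈-filterᵇ⁻ (S ∘ apex) t∈′
                in comp⇐ (trans (saturated K t∈ v∈t) St))
        (λ x⇝v → let t , t∈ , v∈t = triangleOf v
                 in ∈-triVerts⁺ (∈-filterᵇ⁺ (S ∘ apex) t∈ (trans (sym (saturated K t∈ v∈t)) (comp⇒ x⇝v))) v∈t)

      triangles′ : All (IsTriangle H′) ts′
      triangles′ = All.tabulate λ {t} t∈′ →
        let t∈ , St = ∈-filterᵇ⁻ (S ∘ apex) t∈′
            xy , yz , xz = All.lookup triangles t∈
            S₁ = trans (saturated K t∈ (here refl)) St
            S₂ = trans (saturated K t∈ (there (here refl))) St
            S₃ = trans (saturated K t∈ (there (there (here refl)))) St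
        in adj-H′ xy S₁ S₂ , adj-H′ yz S₂ S₃ , adj-H′ xz S₁ S₃

      unique-H′ : Unique H′
      unique-H′ = proj₁ (proj₂ (unique-++⁻ newer (subst Unique split unique-H)))

      edges′ : length (filterᵇ (both S) H′) ≡ edgesIn S
      edges′ = sym (begin
        count (both S) H                         ≡⟨ cong (count (both S)) split ⟩
        count (both S) (newer ++ H′)             ≡⟨ count-++ (both S) newer H′ ⟩
        count (both S) newer + count (both S) H′ ≡⟨ cong (_+ count (both S) H′) none-newer ⟩
        count (both S) H′                        ∎)
        where
        open ≡-Reasoning
        none-newer : count (both S) newer ≡ 0
        none-newer = count-none (both S) newer (All.lookup newer-rejected)

      edge⇔ : ∀ e → (e ∈ filterᵇ (both S) H′) ⇔ ((e ∈ H′) × Comp H′ x₀ (lower e) × Comp H′ x₀ (upper e))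
      edge⇔ e = mk⇔
        (λ e∈′ → let e∈ , inside = ∈-filterᵇ⁻ (both S) e∈′ ; S₁ , S₂ = ∧-true⁻ (S (lower e)) inside
                 in e∈ , comp⇐ S₁ , comp⇐ S₂)
        (λ (e∈ , c₁ , c₂) → ∈-filterᵇ⁺ (both S) e∈ (cong₂ _∧_ (comp⇒ c₁) (comp⇒ c₂)))

      declared : edgesIn S + 1 ≡ 4 * trianglesIn S → DeclareCond H′ (Comp H′ x₀)
      declared tight =
          (ts′ , triangles′ , factor-filterᵇ (S ∘ apex) , corner⇔)
        , 3 * trianglesIn S , edgesIn S
        , (triVerts ts′ , factor-filterᵇ (S ∘ apex) , corner⇔ , length-triVerts ts′)
        , (filterᵇ (both S) H′ , Unique.filter⁺ (λ e → T? (both S e)) unique-H′ , edge⇔ , edges′)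
        , (begin
            3 * edgesIn S + 3     ≡⟨ *-distribˡ-+ 3 (edgesIn S) 1 ⟨
            3 * (edgesIn S + 1)   ≡⟨ cong (3 *_) tight ⟩
            3 * (4 * trianglesIn S) ≡⟨ *-assoc 3 4 (trianglesIn S) ⟨
            12 * trianglesIn S    ≡⟨ *-assoc 4 3 (trianglesIn S) ⟩
            4 * (3 * trianglesIn S) ∎)
        where open ≡-Reasoning

    inner-edge : (K : Cluster a) → Any (λ e → both (members K) e ≡ true) H
    inner-edge {a} K with t , t∈ , a∈t ← triangleOf a
                       with e , e∈ , j ← adj⇒edge (proj₁ (All.lookup triangles t∈)) =
      lose e∈ (trans (both-joins (members K) j)
                     (cong₂ _∧_ K-apex (trans (saturated K t∈ (there (here refl))) K-apex)))
      where
      K-apex : members K (apex t) ≡ true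
      K-apex = trans (sym (saturated K t∈ a∈t)) (∋a K)

    -- When the newest edge inside K was claimed, K was already a whole component of Client's
    -- graph; K did not become good, so rule (3) did not apply to it.
    undeclared-bound : (K : Cluster a) → Closed (members K) H → rootsIn (members K) ≡ 0 →
                       4 * trianglesIn (members K) ≤ edgesIn (members K)
    undeclared-bound K K-closed no-roots with N ← newestEdge (both (members K)) trace (inner-edge K)
      with NewestEdge.outcome N
    ... | inj₁ G-x₀ with r , r∈ , r⇝x₀ ← rooted G-x₀ =
      contradiction (trans (sym (count≡0⇒false (members K) no-roots r∈)) (trans (closed-conn K-closed r⇝x₀) Sx₀)) λ ()
      where open Declaration K K-closed N
    ... | inj₂ undeclared with 4 * trianglesIn (members K) ≤? edgesIn (members K)
    ...   | yes bound = bound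
    ...   | no ¬bound = contradiction (declared tight) undeclared
      where
      open Declaration K K-closed N
      tight : edgesIn S + 1 ≡ 4 * trianglesIn S
      tight = ≤-antisym (subst (_≤ 4 * trianglesIn S) (+-comm 1 (edgesIn S)) (≰⇒> ¬bound)) (dense K)

    component-bound : (K : Cluster a) → Closed (members K) H →
                      4 * trianglesIn (members K) ≤ edgesIn (members K) + rootsIn (members K)
    component-bound K K-closed with rootsIn (members K) in r
    ... | zero  = ≤-trans (undeclared-bound K K-closed r) (≤-reflexive (sym (+-identityʳ _)))
    ... | suc _ = ≤-trans (dense K) (+-monoʳ-≤ (edgesIn (members K)) (s≤s z≤n))

    module Union (F : VSetᵇ) (F-saturated : Saturated F) (F-closed : Closed F H)
                 (F-bound : 4 * trianglesIn F ≤ edgesIn F + rootsIn F)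
                 (K : Cluster a) (K-closed : Closed (members K) H) (a∉F : F a ≡ false) where

      F∪K : VSetᵇ
      F∪K = F ∪ᵇ members K

      K⇒¬F : members K v ≡ true → F v ≡ false
      K⇒¬F Kv = trans (sym (closed-conn F-closed (connected K (∋a K) Kv))) a∉F

      F⇒¬K : F v ≡ true → members K v ≡ false
      F⇒¬K {v} Fv with members K v in Kv
      ... | true  = contradiction (trans (sym Fv) (K⇒¬F Kv)) λ ()
      ... | false = refl

      triangles-∪ : trianglesIn F∪K ≡ trianglesIn F + trianglesIn (members K)
      triangles-∪ = count-∨ (F ∘ apex) (members K ∘ apex) ts λ _ → F⇒¬K

      roots-∪ : rootsIn F∪K ≡ rootsIn F + rootsIn (members K)
      roots-∪ = count-∨ F (members K) roots λ _ → F⇒¬K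

      edges-∪ : edgesIn F∪K ≡ edgesIn F + edgesIn (members K)
      edges-∪ = trans (count-cong (both F∪K) (λ e → both F e ∨ both (members K) e) H split)
                      (count-∨ (both F) (both (members K)) H λ {e} _ → F-edge⇒¬K-edge {e})
        where
        split : e ∈ H → both F∪K e ≡ both F e ∨ both (members K) e
        split {e} e∈ = subst (λ b → (F (lower e) ∨ members K (lower e)) ∧ (b ∨ members K (upper e))
                                    ≡ (F (lower e) ∧ b) ∨ both (members K) e)
                             (F-closed e∈) (∨-∧-same (F (lower e)) _ _)
        F-edge⇒¬K-edge : both F e ≡ true → both (members K) e ≡ false
        F-edge⇒¬K-edge {e} Fe = cong (_∧ members K (upper e)) (F⇒¬K (proj₁ (∧-true⁻ _ Fe)))

      saturated-∪ : Saturated F∪K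
      saturated-∪ = saturated-∪ᵇ F-saturated (saturated K)

      closed-∪ : Closed F∪K H
      closed-∪ e∈ = cong₂ _∨_ (F-closed e∈) (K-closed e∈)

      bound-∪ : 4 * trianglesIn F∪K ≤ edgesIn F∪K + rootsIn F∪K
      bound-∪ = begin
        4 * trianglesIn F∪K                                   ≡⟨ cong (4 *_) triangles-∪ ⟩
        4 * (trianglesIn F + trianglesIn (members K))         ≡⟨ *-distribˡ-+ 4 (trianglesIn F) _ ⟩
        4 * trianglesIn F + 4 * trianglesIn (members K)       ≤⟨ +-mono-≤ F-bound (component-bound K K-closed) ⟩
        (edgesIn F + rootsIn F) + (edgesIn (members K) + rootsIn (members K)) ≡⟨ +-interchange (edgesIn F) _ _ _ ⟩
        (edgesIn F + edgesIn (members K)) + (rootsIn F + rootsIn (members K)) ≡⟨ cong₂ _+_ edges-∪ roots-∪ ⟨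
        edgesIn F∪K + rootsIn F∪K                             ∎
        where open ≤-Reasoning

      triangles-grow : suc (trianglesIn F) ≤ trianglesIn F∪K
      triangles-grow with t , t∈ , a∈t ← triangleOf a = begin
        suc (trianglesIn F)                          ≡⟨ +-comm 1 (trianglesIn F) ⟩
        trianglesIn F + 1                            ≤⟨ +-monoʳ-≤ (trianglesIn F) K-nonempty ⟩
        trianglesIn F + trianglesIn (members K)      ≡⟨ triangles-∪ ⟨
        trianglesIn F∪K                              ∎
        where
        open ≤-Reasoning
        K-nonempty : 1 ≤ trianglesIn (members K)
        K-nonempty = count-pos (members K ∘ apex) t∈ (trans (sym (saturated K t∈ a∈t)) (∋a K))

    exhaust : ∀ k F → Saturated F → Closed F H → 4 * trianglesIn F ≤ edgesIn F + rootsIn F →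
              length ts ≤ trianglesIn F + k → 4 * length ts ≤ length H + length roots
    exhaust k F F-saturated F-closed F-bound fuel with all⊎counterexample (λ t → F (apex t) Bool.≟ true) ts
    ... | inj₁ all = begin
      4 * length ts           ≡⟨ cong (4 *_) (count-all (F ∘ apex) ts (All.lookup all)) ⟨
      4 * trianglesIn F       ≤⟨ F-bound ⟩
      edgesIn F + rootsIn F   ≤⟨ +-mono-≤ (count≤length (both F) H) (count≤length F roots) ⟩
      length H + length roots ∎
      where open ≤-Reasoning
    ... | inj₂ (t , _ , t∉F) with K , K-closed ← component (apex t) | k
    ...   | zero   = ⊥-elim (fuel-exhausted fuel triangles-grow (count≤length _ ts))
      where open Union F F-saturated F-closed F-bound K K-closed (¬-not t∉F)
    ...   | suc k′ = exhaust k′ F∪K saturated-∪ closed-∪ bound-∪ (fuel-step k′ fuel triangles-grow)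
      where open Union F F-saturated F-closed F-bound K K-closed (¬-not t∉F)

    edge-bound : 4 * length ts ≤ length H + d
    edge-bound = subst (λ k → 4 * length ts ≤ length H + k) (proj₁ (proj₂ (declaredRoots trace)))
      (exhaust (length ts) ∅ᵇ (λ _ _ → refl) (λ _ → refl)
        (subst (λ k → 4 * k ≤ edgesIn ∅ᵇ + rootsIn ∅ᵇ) (sym trianglesIn-∅) z≤n)
        (subst (λ k → length ts ≤ k + length ts) (sym trianglesIn-∅) ≤-refl))

clientEdges⊆offered : ∀ {n} (rs : List (Round n)) {e} → e ∈ clientEdges rs →
                      e ∈ concatMap (λ { (c , w) → c ∷ w ∷ [] }) rs
clientEdges⊆offered (_ ∷ rs) (here refl) = here refl
clientEdges⊆offered (_ ∷ rs) (there e∈)  = there (there (clientEdges⊆offered rs e∈))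

validPlay⇒unique : ∀ {n} (rs : List (Round n)) → ValidPlay rs → Unique (clientEdges rs)
validPlay⇒unique []       _              = []
validPlay⇒unique (_ ∷ rs) (c∉ ∷ _ ∷ u) =
  All.tabulate (λ e∈ → All.lookup c∉ (there (clientEdges⊆offered rs e∈))) ∷ validPlay⇒unique rs u

seven-sixths : ∀ n m L d → n ≤ 3 * m → 4 * m ≤ L + d → 6 * d ≤ n → 7 * n ≤ 6 * L
seven-sixths n m L d n≤3m 4m≤L+d 6d≤n = +-cancelˡ-≤ n _ _ (begin
  8 * n           ≤⟨ *-monoʳ-≤ 8 n≤3m ⟩
  8 * (3 * m)     ≡⟨ *-assoc 8 3 m ⟨
  24 * m          ≡⟨ *-assoc 6 4 m ⟩
  6 * (4 * m)     ≤⟨ *-monoʳ-≤ 6 4m≤L+d ⟩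
  6 * (L + d)     ≡⟨ *-distribˡ-+ 6 L d ⟩
  6 * L + 6 * d   ≤⟨ +-monoʳ-≤ (6 * L) 6d≤n ⟩
  6 * L + n       ≡⟨ +-comm (6 * L) n ⟩
  n + 6 * L       ∎)
  where open ≤-Reasoning

mainTheorem3 : (n : ℕ) → 3 ∣ n → (rs : List (Round n)) → ValidPlay rs → WaiterWon rs →
    (G : VSet {n}) → (d : ℕ) → GoodTrace (reverse (clientEdges rs)) G d → 6 * d ≤ n →
    7 * n ≤ 6 * length (clientEdges rs)
mainTheorem3 n _ rs valid ((ts , triangles , factor , spanning) , _) G d trace 6d≤n =
  seven-sixths n (length ts) (length (clientEdges rs)) d (spanning⇒n≤3*length ts covers) 4|ts|≤L+d 6d≤n
  where
  covers : ∀ v → v ∈ triVerts ts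
  covers v = Equivalence.from (spanning v) tt
  H = reverse (clientEdges rs)
  open Factor H ts (All.map (isTriangle-mono Any.reverse⁺) triangles) factor covers
  4|ts|≤L+d : 4 * length ts ≤ length (clientEdges rs) + d
  4|ts|≤L+d = subst (λ L → 4 * length ts ≤ L + d) (length-reverse (clientEdges rs))
    (Game.edge-bound trace (unique-reverse (validPlay⇒unique rs valid)))
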